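{- Let $\mathcal U$ be a universe that is univalent for contractible types, and let $Q$ be a proposition. Then the subtype of $\mathcal U$ consisting of $Q$-contractible types is $Q$-contractible.
   Context: Homotopy type theory. A type $A$ is $Q$-contractible if $Q\to\mathrm{isContr}(A)$. $\mathcal U$ is univalent for contractible types if for contractible $A,B:\mathcal U$ the canonical map $(A=B)\to(A\simeq B)$ is an equivalence. -}

module Defs where

open import Level using (Level; _⊔_; suc)
open import Data.Product using (Σ; _,_; proj₁; proj₂; _×_)
open import Relation.Binary.PropositionalEquality using (_≡_; refl)

isContr : ∀ {ℓ} → Set ℓ → Set ℓ
isContr A = Σ A λ a → (x : A) → a ≡ x

isProp : ∀ {ℓ} → Set ℓ → Set ℓ
isProp A = (x y : A) → x ≡ y

fiber : ∀ {a b} {A : Set a} {B : Set b} → (A → B) → B → Set (a ⊔ b)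
fiber {A = A} f y = Σ A λ x → f x ≡ y

isEquiv : ∀ {a b} {A : Set a} {B : Set b} → (A → B) → Set (a ⊔ b)
isEquiv {B = B} f = (y : B) → isContr (fiber f y)

_≃_ : ∀ {a b} → Set a → Set b → Set (a ⊔ b)
A ≃ B = Σ (A → B) isEquiv

idEquiv : ∀ {a} (A : Set a) → A ≃ A
idEquiv A = (λ x → x) , λ y → (y , refl) , λ { (x , refl) → refl }

idtoeqv : ∀ {ℓ} {A B : Set ℓ} → A ≡ B → A ≃ B
idtoeqv {A = A} refl = idEquiv A

UnivalentForContr : (ℓ : Level) → Set (suc ℓ)
UnivalentForContr ℓ = (A B : Set ℓ) → isContr A → isContr B →
  isEquiv (idtoeqv {A = A} {B = B})

_-Contractible_ : ∀ {q ℓ} → Set q → Set ℓ → Set (q ⊔ ℓ)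
Q -Contractible A = Q → isContr A

QContrTypes : ∀ {q} (ℓ : Level) → Set q → Set (q ⊔ suc ℓ)
QContrTypes ℓ Q = Σ (Set ℓ) λ A → Q -Contractible A

{-# OPTIONS --safe #-}
module Submission where

-- Given q : Q, every Q-contractible type is contractible, so the centre (⊤ , λ _ → ⊤-isContr)
-- is connected to each (A , c) by the path ⊤ ≡ A that univalence for contractible types
-- extracts from the equivalence between two contractible types; the second components then
-- agree because Q → isContr ⊤ is a proposition.

open import Defs
open import Level using (Level)
open import Axiom.Extensionality.Propositional using (Extensionality)
open import Data.Product using (Σ; _,_; proj₁)
open import Data.Unit.Polymorphic using (⊤; tt)
open import Relation.Binary.PropositionalEquality
  using (_≡_; refl; sym; trans; cong; trans-symˡ)

private
  variable
    a b ℓ : Level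
    A : Set a

isContr⇒≡-isProp : isContr A → (x y : A) → isProp (x ≡ y)
isContr⇒≡-isProp (_ , contraction) x y p q = trans (canonical p) (sym (canonical q))
  where
  canonical : ∀ {x y} (r : x ≡ y) → r ≡ trans (sym (contraction x)) (contraction y)
  canonical {x} refl = sym (trans-symˡ (contraction x))

Π-isProp : {A : Set a} {B : A → Set b} → Extensionality a b →
  ((x : A) → isProp (B x)) → isProp ((x : A) → B x)
Π-isProp ext B-isProp f g = ext λ x → B-isProp x (f x) (g x)

Σ-≡-isProp : {P : A → Set b} {x y : A} → isProp (P x) →
  (p : x ≡ y) (u : P x) (v : P y) → _≡_ {A = Σ A P} (x , u) (y , v)
Σ-≡-isProp {x = x} P-isProp refl u v = cong (x ,_) (P-isProp u v)

⊤-isContr : isContr (⊤ {ℓ})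
⊤-isContr = tt , λ _ → refl

-- By η for ⊤ and for functions out of it, a contraction of ⊤ is determined by its value at tt,
-- so no extensionality is needed here.
isContr-⊤-isProp : isProp (isContr (⊤ {ℓ}))
isContr-⊤-isProp (_ , h) (_ , h') =
  cong (λ r → tt , λ _ → r) (isContr⇒≡-isProp ⊤-isContr tt tt (h tt) (h' tt))

isContr⇒≃ : {B : Set b} → isContr A → isContr B → A ≃ B
isContr⇒≃ {A = A} {B = B} (a , contractA) (b , contractB) = (λ _ → b) , const-isEquiv
  where
  B-≡-isProp : (x y : B) → isProp (x ≡ y)
  B-≡-isProp = isContr⇒≡-isProp (b , contractB)

  fibre-≡ : ∀ {y x x'} → x ≡ x' → (s : b ≡ y) (r : b ≡ y) →
    _≡_ {A = fiber (λ (_ : A) → b) y} (x , s) (x' , r)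
  fibre-≡ {y} refl s r = cong (_ ,_) (B-≡-isProp b y s r)

  const-isEquiv : isEquiv (λ (_ : A) → b)
  const-isEquiv y = (a , contractB y) , λ (x , r) → fibre-≡ (contractA x) (contractB y) r

ua-isContr : UnivalentForContr ℓ → {A B : Set ℓ} → isContr A → isContr B → A ≡ B
ua-isContr ua {A} {B} A-isContr B-isContr =
  proj₁ (proj₁ (ua A B A-isContr B-isContr (isContr⇒≃ A-isContr B-isContr)))

lemmaB4 : ∀ {q} (ℓ : Level) → Extensionality q ℓ → UnivalentForContr ℓ →
    (Q : Set q) → isProp Q → Q -Contractible (QContrTypes ℓ Q)
lemmaB4 ℓ ext ua Q _ q₀ = centre , λ (_ , c) →
  Σ-≡-isProp (Π-isProp ext λ _ → isContr-⊤-isProp) (ua-isContr ua ⊤-isContr (c q₀)) _ c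
  where
  centre : QContrTypes ℓ Q
  centre = ⊤ , λ _ → ⊤-isContr
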